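{- There is no cubic graph $G$ having a proper $5$-edge-coloring $c$ with exactly one abnormal edge, i.e. with $|N_G(c)|=1$.
   Context: Graphs are finite, undirected, loopless, and may have parallel edges. A proper $5$-edge-coloring assigns colors from $\{1,\dots,5\}$ to edges so that adjacent edges get different colors. For an edge-coloring $c$, $S_c(v)$ is the set of colors on edges incident to $v$. An edge $uv$ of a cubic graph is poor if $|S_c(u)\cup S_c(v)|=3$, rich if $|S_c(u)\cup S_c(v)|=5$, and abnormal otherwise. $N_G(c)$ is the set of abnormal edges of $G$ with respect to $c$. -}

module Defs where

open import Data.Nat using (ℕ)
open import Data.Fin using (Fin)
open import Data.Fin.Properties using (_≟_; any?)
open import Data.Fin.Subset using (Subset; ∣_∣; _∪_; _∈_)
open import Data.Vec using (tabulate)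
open import Data.Bool using (Bool)
open import Data.Product using (Σ; ∃; _×_; _,_; proj₁; proj₂)
open import Data.Sum using (_⊎_)
open import Relation.Nullary using (¬_; Dec; yes; no)
open import Relation.Nullary.Decidable using (⌊_⌋)
open import Relation.Binary.PropositionalEquality using (_≡_)

record Multigraph : Set where
  field
    nV    : ℕ
    nE    : ℕ
    end₁  : Fin nE → Fin nV
    end₂  : Fin nE → Fin nV
    loopless : ∀ e → ¬ (end₁ e ≡ end₂ e)

open Multigraph public

Incident : (G : Multigraph) → Fin (nE G) → Fin (nV G) → Set
Incident G e v = (end₁ G e ≡ v) ⊎ (end₂ G e ≡ v)

incident? : (G : Multigraph) → (e : Fin (nE G)) → (v : Fin (nV G)) → Dec (Incident G e v)
incident? G e v with end₁ G e ≟ v | end₂ G e ≟ v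
... | yes p | _ = yes (Data.Sum.inj₁ p)
... | no _ | yes q = yes (Data.Sum.inj₂ q)
... | no p | no q = no λ { (Data.Sum.inj₁ x) → p x ; (Data.Sum.inj₂ x) → q x }

incidentEdges : (G : Multigraph) → Fin (nV G) → Subset (nE G)
incidentEdges G v = tabulate λ e → ⌊ incident? G e v ⌋

-- cubic: every vertex has degree 3 (graph is loopless, so degree = number of incident edges)
Cubic : Multigraph → Set
Cubic G = ∀ v → ∣ incidentEdges G v ∣ ≡ 3

-- 5-edge-colorings (colors Fin 5 standing for {1,…,5})
EdgeColoring : Multigraph → Set
EdgeColoring G = Fin (nE G) → Fin 5

Proper : (G : Multigraph) → EdgeColoring G → Set
Proper G c = ∀ e f v → ¬ (e ≡ f) → Incident G e v → Incident G f v → ¬ (c e ≡ c f)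

S : (G : Multigraph) → EdgeColoring G → Fin (nV G) → Subset 5
S G c v = tabulate λ k → ⌊ any? (λ e → incident? G e v ×-dec (c e ≟ k)) ⌋
  where open import Relation.Nullary using (_×-dec_)

Abnormal : (G : Multigraph) → EdgeColoring G → Fin (nE G) → Set
Abnormal G c e = ¬ (∣ S G c (end₁ G e) ∪ S G c (end₂ G e) ∣ ≡ 3)
               × ¬ (∣ S G c (end₁ G e) ∪ S G c (end₂ G e) ∣ ≡ 5)

ExactlyOneAbnormal : (G : Multigraph) → EdgeColoring G → Set
ExactlyOneAbnormal G c = Σ (Fin (nE G)) λ e → Abnormal G c e × (∀ f → Abnormal G c f → f ≡ e)

-- Identify a vertex v with the pair of colours missing at v. A poor edge joins equal pairs, a
-- rich edge disjoint pairs, and an abnormal edge pairs sharing exactly one colour. Give the dart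
-- (v, e) the class (ΣS(v) − 3c(e))² mod 5. At each vertex exactly one dart has class 0 and the
-- other two share a nonzero class; the two darts of a poor edge coincide, those of a rich edge
-- have opposite values of ΣS(v) − 3c(e), and those of an abnormal edge get different classes.
-- So for each nonzero class q every vertex carries an even number of darts of class q, hence an
-- even number of edges have exactly one end-dart of class q; a unique abnormal edge would make
-- this number odd for a suitable q.
module Submission where

open import Defs
open import Relation.Nullary using (¬_; Dec; yes; no; ¬?; _×-dec_; _→-dec_; contradiction)
open import Data.Product using (Σ; _×_; ∃-syntax; _,_; proj₂)

open import Algebra.Bundles using (CommutativeMonoid; CommutativeRing)
open import Data.Bool using (Bool; true; false; if_then_else_; _xor_)
open import Data.Bool.Properties using (xor-∧-commutativeRing; xor-same) renaming (_≟_ to _≟ᵇ_)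
open import Data.Fin using (Fin; zero; toℕ; punchIn)
open import Data.Fin.Properties using (_≟_; any?; all?; punchInᵢ≢i)
open import Data.Fin.Subset using (Subset; ∣_∣; _∪_; _∈_; inside; outside)
open import Data.Fin.Subset.Properties using (_∈?_; anySubset?)
open import Data.Nat using (ℕ; suc; _+_; _*_; _^_)
open import Data.Nat.DivMod using (_mod_)
import Data.Nat.Properties as ℕ
open import Data.Sum using (inj₁; inj₂)
open import Data.Unit using (tt)
open import Data.Vec using ([]; _∷_; lookup)
open import Data.Vec.Properties using (lookup∘tabulate; lookup⇒[]=)
open import Function using (_∘_)
open import Relation.Nullary.Decidable using (⌊_⌋; map′; toWitness; decidable-stable; isYes≗does; dec-true)
open import Relation.Unary using (Pred; Decidable)
open import Relation.Binary.PropositionalEquality using (_≡_; _≢_; refl; sym; trans; cong; module ≡-Reasoning)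

isYes-distinguishes : ∀ {p q} {P : Set p} {Q : Set q} (P? : Dec P) (Q? : Dec Q) → P → ¬ Q → ⌊ P? ⌋ ≢ ⌊ Q? ⌋
isYes-distinguishes (yes _) (no _)  _ _  ()
isYes-distinguishes (yes _) (yes q) _ ¬q _ = ¬q q
isYes-distinguishes (no ¬p) _       p _  _ = ¬p p

separatingPoint : ∀ {n} (z : Fin n) {p₁ p₂ : Fin n} → p₁ ≢ p₂ → ∃[ q ] q ≢ z × ⌊ p₁ ≟ q ⌋ ≢ ⌊ p₂ ≟ q ⌋
separatingPoint z {p₁} {p₂} p₁≢p₂ with p₁ ≟ z
... | yes refl = p₂ , p₁≢p₂ ∘ sym , isYes-distinguishes (p₂ ≟ p₂) (p₁ ≟ p₂) refl p₁≢p₂ ∘ sym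
... | no p₁≢z  = p₁ , p₁≢z , isYes-distinguishes (p₁ ≟ p₁) (p₂ ≟ p₁) refl (p₁≢p₂ ∘ sym)

∀-Subset? : ∀ {n p} {P : Pred (Subset n) p} → Decidable P → Dec (∀ A → P A)
∀-Subset? P? = map′ (λ ∄¬P A → decidable-stable (P? A) (∄¬P ∘ (A ,_)))
                    (λ ∀P (A , ¬PA) → ¬PA (∀P A))
                    (¬? (anySubset? (¬? ∘ P?)))

lookup-incidentEdges : ∀ G v e → lookup (incidentEdges G v) e ≡ ⌊ incident? G e v ⌋
lookup-incidentEdges G v = lookup∘tabulate (λ e → ⌊ incident? G e v ⌋)

lookup-S : ∀ G c v k → lookup (S G c v) k ≡ ⌊ any? (λ e → incident? G e v ×-dec (c e ≟ k)) ⌋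
lookup-S G c v = lookup∘tabulate (λ k → ⌊ any? (λ e → incident? G e v ×-dec (c e ≟ k)) ⌋)

proper⇒injectiveAt : ∀ G c → Proper G c → ∀ {v e f} → Incident G e v → Incident G f v → c e ≡ c f → e ≡ f
proper⇒injectiveAt G c proper {v} {e} {f} e∋v f∋v ce≡cf =
  decidable-stable (e ≟ f) (λ e≢f → proper e f v e≢f e∋v f∋v ce≡cf)

colour∈S : ∀ G c {e v} → Incident G e v → c e ∈ S G c v
colour∈S G c {e} {v} e∋v = lookup⇒[]= (c e) (S G c v)
  (trans (lookup-S G c v (c e)) (trans (isYes≗does colourSeen?) (dec-true colourSeen? (e , e∋v , refl))))
  where colourSeen? = any? (λ f → incident? G f v ×-dec (c f ≟ c e))

module CommutativeMonoidSums {a ℓ} (M : CommutativeMonoid a ℓ) where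

  open CommutativeMonoid M using (Carrier; _≈_; _∙_; setoid; reflexive; ∙-cong; ∙-congˡ; identityˡ; identityʳ)
    renaming (ε to 0#; refl to ≈-refl; sym to ≈-sym; trans to ≈-trans)
  open import Algebra.Properties.CommutativeMonoid.Sum M public
    using (sum; sum-syntax; ∑-comm; ∑-distrib-+; sum-remove; sum-cong-≋; sum-cong-≗; sum-replicate-zero)
  open import Relation.Binary.Reasoning.Setoid setoid

  if-yes : ∀ {p} {P : Set p} (P? : Dec P) {x : Carrier} → P → (if ⌊ P? ⌋ then x else 0#) ≈ x
  if-yes (yes _) _ = ≈-refl
  if-yes (no ¬p) p = contradiction p ¬p

  if-no : ∀ {p} {P : Set p} (P? : Dec P) {x : Carrier} → ¬ P → (if ⌊ P? ⌋ then x else 0#) ≈ 0#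
  if-no (yes p) ¬p = contradiction p ¬p
  if-no (no _)  _  = ≈-refl

  ∑-zero : ∀ {n} (f : Fin n → Carrier) → (∀ i → f i ≈ 0#) → ∑[ i < n ] f i ≈ 0#
  ∑-zero {n} f f≈0 = ≈-trans (sum-cong-≋ f≈0) (sum-replicate-zero n)

  ∑-select : ∀ {n} (f : Fin n → Carrier) (a : Fin n) → (∀ i → i ≢ a → f i ≈ 0#) → ∑[ i < n ] f i ≈ f a
  ∑-select {suc _} f a f≈0 = begin
    sum f                     ≈⟨ sum-remove f ⟩
    f a ∙ sum (f ∘ punchIn a) ≈⟨ ∙-congˡ (∑-zero _ (λ i → f≈0 (punchIn a i) (punchInᵢ≢i a i))) ⟩
    f a ∙ 0#                  ≈⟨ identityʳ (f a) ⟩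
    f a                       ∎

  ∑-indicator : ∀ {n} (a : Fin n) (h : Fin n → Carrier) → ∑[ i < n ] (if ⌊ a ≟ i ⌋ then h i else 0#) ≈ h a
  ∑-indicator a h = ≈-trans (∑-select _ a (λ i i≢a → if-no (a ≟ i) (i≢a ∘ sym))) (if-yes (a ≟ a) refl)

  ∑-reindex : ∀ {m k p} {P : Pred (Fin m) p} (P? : Decidable P) (c : Fin m → Fin k) (φ : Fin k → Carrier) →
              (∀ {e f} → P e → P f → c e ≡ c f → e ≡ f) →
              ∑[ e < m ] (if ⌊ P? e ⌋ then φ (c e) else 0#) ≈
              ∑[ j < k ] (if ⌊ any? (λ e → P? e ×-dec (c e ≟ j)) ⌋ then φ j else 0#)
  ∑-reindex {m} {k} {P = P} P? c φ injective = begin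
    ∑[ e < m ] (if ⌊ P? e ⌋ then φ (c e) else 0#)                            ≈⟨ sum-cong-≋ (spread ∘ P?) ⟩
    ∑[ e < m ] ∑[ j < k ] (if ⌊ P? e ×-dec (c e ≟ j) ⌋ then φ j else 0#)    ≈⟨ ∑-comm (λ e j → term e j) ⟩
    ∑[ j < k ] ∑[ e < m ] (if ⌊ P? e ×-dec (c e ≟ j) ⌋ then φ j else 0#)    ≈⟨ sum-cong-≋ gather ⟩
    ∑[ j < k ] (if ⌊ any? (λ e → P? e ×-dec (c e ≟ j)) ⌋ then φ j else 0#) ∎
    where
    term : Fin m → Fin k → Carrier
    term e j = if ⌊ P? e ×-dec (c e ≟ j) ⌋ then φ j else 0#

    spread : ∀ {e} (d : Dec (P e)) →
             (if ⌊ d ⌋ then φ (c e) else 0#) ≈ ∑[ j < k ] (if ⌊ d ×-dec (c e ≟ j) ⌋ then φ j else 0#)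
    spread {e} (yes pe) = ≈-sym (≈-trans
      (∑-select _ (c e) (λ j j≢ce → if-no (yes pe ×-dec (c e ≟ j)) (j≢ce ∘ sym ∘ proj₂)))
      (if-yes (yes pe ×-dec (c e ≟ c e)) (pe , refl)))
    spread (no _) = ≈-sym (∑-zero {k} _ (λ _ → ≈-refl))

    gather : ∀ j → ∑[ e < m ] term e j ≈ (if ⌊ any? (λ e → P? e ×-dec (c e ≟ j)) ⌋ then φ j else 0#)
    gather j with any? (λ e → P? e ×-dec (c e ≟ j))
    ... | yes (e , pe , ce≡j) = ≈-trans
      (∑-select _ e (λ f f≢e → if-no (P? f ×-dec (c f ≟ j))
        (λ (pf , cf≡j) → f≢e (injective pf pe (trans cf≡j (sym ce≡j))))))
      (if-yes (P? e ×-dec (c e ≟ j)) (pe , ce≡j))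
    ... | no ∄e = ∑-zero _ (λ e → if-no (P? e ×-dec (c e ≟ j)) (∄e ∘ (e ,_)))

  ∑-incidences : (G : Multigraph) (w : Fin (nV G) → Fin (nE G) → Carrier) →
                 ∑[ v < nV G ] ∑[ e < nE G ] (if ⌊ incident? G e v ⌋ then w v e else 0#) ≈
                 ∑[ e < nE G ] (w (end₁ G e) e ∙ w (end₂ G e) e)
  ∑-incidences G w = ≈-trans (∑-comm (λ v e → if ⌊ incident? G e v ⌋ then w v e else 0#)) (sum-cong-≋ λ e → begin
    ∑[ v < nV G ] (if ⌊ incident? G e v ⌋ then w v e else 0#)          ≈⟨ sum-cong-≋ (split e) ⟩
    ∑[ v < nV G ] (at (end₁ G e) e v ∙ at (end₂ G e) e v)              ≈⟨ ∑-distrib-+ (at (end₁ G e) e) (at (end₂ G e) e) ⟩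
    ∑[ v < nV G ] at (end₁ G e) e v ∙ ∑[ v < nV G ] at (end₂ G e) e v
      ≈⟨ ∙-cong (∑-indicator (end₁ G e) (λ v → w v e)) (∑-indicator (end₂ G e) (λ v → w v e)) ⟩
    w (end₁ G e) e ∙ w (end₂ G e) e                                     ∎)
    where
    at : Fin (nV G) → Fin (nE G) → Fin (nV G) → Carrier
    at a e v = if ⌊ a ≟ v ⌋ then w v e else 0#

    split : ∀ e v → (if ⌊ incident? G e v ⌋ then w v e else 0#) ≈ at (end₁ G e) e v ∙ at (end₂ G e) e v
    split e v with end₁ G e ≟ v | end₂ G e ≟ v
    ... | yes p | yes q = contradiction (trans p (sym q)) (loopless G e)
    ... | yes _ | no _  = ≈-sym (identityʳ _)
    ... | no _  | yes _ = ≈-sym (identityˡ _)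
    ... | no _  | no _  = ≈-sym (identityˡ 0#)

  ∑-coloursAt : ∀ G c → Proper G c → ∀ v (φ : Fin 5 → Carrier) →
                ∑[ e < nE G ] (if ⌊ incident? G e v ⌋ then φ (c e) else 0#) ≈
                ∑[ k < 5 ] (if lookup (S G c v) k then φ k else 0#)
  ∑-coloursAt G c proper v φ = ≈-trans
    (∑-reindex (λ e → incident? G e v) c φ (proper⇒injectiveAt G c proper))
    (reflexive (sum-cong-≗ {5} (λ k → cong (λ b → if b then φ k else 0#) (sym (lookup-S G c v k)))))

module _ where
  open CommutativeMonoidSums ℕ.+-0-commutativeMonoid
  open ≡-Reasoning

  ∣p∣≡∑ : ∀ {n} (p : Subset n) → ∣ p ∣ ≡ ∑[ i < n ] (if lookup p i then 1 else 0)
  ∣p∣≡∑ []            = refl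
  ∣p∣≡∑ (inside ∷ p)  = cong suc (∣p∣≡∑ p)
  ∣p∣≡∑ (outside ∷ p) = ∣p∣≡∑ p

  ∣S∣≡degree : ∀ G c → Proper G c → ∀ v → ∣ S G c v ∣ ≡ ∣ incidentEdges G v ∣
  ∣S∣≡degree G c proper v = begin
    ∣ S G c v ∣                                                    ≡⟨ ∣p∣≡∑ (S G c v) ⟩
    ∑[ k < 5 ] (if lookup (S G c v) k then 1 else 0)               ≡⟨ ∑-coloursAt G c proper v (λ _ → 1) ⟨
    ∑[ e < nE G ] (if ⌊ incident? G e v ⌋ then 1 else 0)
      ≡⟨ sum-cong-≗ {nE G} (λ e → cong (λ b → if b then 1 else 0) (lookup-incidentEdges G v e)) ⟨
    ∑[ e < nE G ] (if lookup (incidentEdges G v) e then 1 else 0)  ≡⟨ ∣p∣≡∑ (incidentEdges G v) ⟨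
    ∣ incidentEdges G v ∣                                          ∎

  colourSum : ∀ {n} → Subset n → ℕ
  colourSum {n} A = ∑[ i < n ] (if lookup A i then toℕ i else 0)

-- (ΣA − 3j)² mod 5, with −3j written as 2j to avoid truncated subtraction.
dartClass : Subset 5 → Fin 5 → Fin 5
dartClass A j = ((colourSum A + 2 * toℕ j) ^ 2) mod 5

AbnormalPair : ∀ {n} → Subset n → Subset n → Set
AbnormalPair A B = ¬ (∣ A ∪ B ∣ ≡ 3) × ¬ (∣ A ∪ B ∣ ≡ 5)

abnormalPair? : ∀ {n} (A B : Subset n) → Dec (AbnormalPair A B)
abnormalPair? A B = ¬? (∣ A ∪ B ∣ ℕ.≟ 3) ×-dec ¬? (∣ A ∪ B ∣ ℕ.≟ 5)

dartClass-normal : ∀ A B → ∣ A ∣ ≡ 3 → ∣ B ∣ ≡ 3 → ∀ j → j ∈ A → j ∈ B → ¬ AbnormalPair A B →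
                   dartClass A j ≡ dartClass B j
dartClass-normal = toWitness {a? = ∀-Subset? λ A → ∀-Subset? λ B →
  (∣ A ∣ ℕ.≟ 3) →-dec (∣ B ∣ ℕ.≟ 3) →-dec all? λ j → (j ∈? A) →-dec (j ∈? B) →-dec
  ¬? (abnormalPair? A B) →-dec (dartClass A j ≟ dartClass B j)} tt

dartClass-abnormal : ∀ A B → ∣ A ∣ ≡ 3 → ∣ B ∣ ≡ 3 → ∀ j → j ∈ A → j ∈ B → AbnormalPair A B →
                     dartClass A j ≢ dartClass B j
dartClass-abnormal = toWitness {a? = ∀-Subset? λ A → ∀-Subset? λ B →
  (∣ A ∣ ℕ.≟ 3) →-dec (∣ B ∣ ℕ.≟ 3) →-dec all? λ j → (j ∈? A) →-dec (j ∈? B) →-dec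
  abnormalPair? A B →-dec ¬? (dartClass A j ≟ dartClass B j)} tt

module _ where
  open CommutativeMonoidSums (CommutativeRing.+-commutativeMonoid xor-∧-commutativeRing)
  open ≡-Reasoning

  dartClass-even : ∀ A → ∣ A ∣ ≡ 3 → ∀ q → q ≢ zero →
                   ∑[ j < 5 ] (if lookup A j then ⌊ dartClass A j ≟ q ⌋ else false) ≡ false
  dartClass-even = toWitness {a? = ∀-Subset? λ A → (∣ A ∣ ℕ.≟ 3) →-dec all? λ q → ¬? (q ≟ zero) →-dec
    (∑[ j < 5 ] (if lookup A j then ⌊ dartClass A j ≟ q ⌋ else false) ≟ᵇ false)} tt

  xor≡false⇒≡ : ∀ {x y} → x xor y ≡ false → x ≡ y
  xor≡false⇒≡ {false} {false} _ = refl
  xor≡false⇒≡ {true}  {true}  _ = refl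

  lastEdge-agrees : (G : Multigraph) (w : Fin (nV G) → Fin (nE G) → Bool) →
                    (∀ v → ∑[ e < nE G ] (if ⌊ incident? G e v ⌋ then w v e else false) ≡ false) →
                    ∀ e₀ → (∀ e → e ≢ e₀ → w (end₁ G e) e ≡ w (end₂ G e) e) →
                    w (end₁ G e₀) e₀ ≡ w (end₂ G e₀) e₀
  lastEdge-agrees G w even e₀ agree = xor≡false⇒≡ (begin
    w (end₁ G e₀) e₀ xor w (end₂ G e₀) e₀
      ≡⟨ ∑-select _ e₀ (λ e e≢e₀ → trans (cong (_xor w (end₂ G e) e) (agree e e≢e₀)) (xor-same (w (end₂ G e) e))) ⟨
    ∑[ e < nE G ] (w (end₁ G e) e xor w (end₂ G e) e)
      ≡⟨ ∑-incidences G w ⟨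
    ∑[ v < nV G ] ∑[ e < nE G ] (if ⌊ incident? G e v ⌋ then w v e else false)
      ≡⟨ ∑-zero _ even ⟩
    false ∎)

  module _ {G : Multigraph} (cubic : Cubic G) {c : EdgeColoring G} (proper : Proper G c) where

    ∣S∣≡3 : ∀ v → ∣ S G c v ∣ ≡ 3
    ∣S∣≡3 v = trans (∣S∣≡degree G c proper v) (cubic v)

    endClasses-agree : ∀ e → ¬ Abnormal G c e → dartClass (S G c (end₁ G e)) (c e) ≡ dartClass (S G c (end₂ G e)) (c e)
    endClasses-agree e = dartClass-normal _ _ (∣S∣≡3 (end₁ G e)) (∣S∣≡3 (end₂ G e)) (c e)
                                          (colour∈S G c (inj₁ refl)) (colour∈S G c (inj₂ refl))

    endClasses-differ : ∀ e → Abnormal G c e → dartClass (S G c (end₁ G e)) (c e) ≢ dartClass (S G c (end₂ G e)) (c e)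
    endClasses-differ e = dartClass-abnormal _ _ (∣S∣≡3 (end₁ G e)) (∣S∣≡3 (end₂ G e)) (c e)
                                             (colour∈S G c (inj₁ refl)) (colour∈S G c (inj₂ refl))

    classCount-even : ∀ q → q ≢ zero → ∀ v →
                      ∑[ e < nE G ] (if ⌊ incident? G e v ⌋ then ⌊ dartClass (S G c v) (c e) ≟ q ⌋ else false) ≡ false
    classCount-even q q≢0 v = trans (∑-coloursAt G c proper v (λ k → ⌊ dartClass (S G c v) k ≟ q ⌋))
                                    (dartClass-even (S G c v) (∣S∣≡3 v) q q≢0)

proposition3 : (G : Multigraph) → Cubic G → ¬ (Σ (EdgeColoring G) λ c → Proper G c × ExactlyOneAbnormal G c)
proposition3 G cubic (c , proper , e₀ , e₀-abnormal , e₀-unique) =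
  let q , q≢0 , separates = separatingPoint zero (endClasses-differ cubic proper e₀ e₀-abnormal)
  in separates (lastEdge-agrees G (λ v e → ⌊ dartClass (S G c v) (c e) ≟ q ⌋) (classCount-even cubic proper q q≢0) e₀
                 (λ e e≢e₀ → cong (λ p → ⌊ p ≟ q ⌋) (endClasses-agree cubic proper e (e≢e₀ ∘ e₀-unique e))))
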